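{- Let $k \ge 2$ be an even integer and let $D$ be a $k$-quasi-transitive digraph. If $P = (u_0, u_1, \dots, u_{k+2})$ is a $u_0u_{k+2}$-path of minimum length in $D$ (so $d(u_0,u_{k+2}) = k+2$), then $(u_{k+2}, w) \in A(D)$ for every $w \in V(D)$ with $d(u_0, w) \le k$.
   Context: All digraphs are finite, without loops and without multiple arcs in the same direction; paths are directed. $d(u,v)$ is the length of a shortest directed $uv$-path ($d(v,v)=0$). $D$ is $k$-quasi-transitive if for every directed path $(v_0, \dots, v_k)$ of length $k$, $(v_0,v_k) \in A(D)$ or $(v_k,v_0) \in A(D)$. -}

module Defs where

open import Data.Nat using (ℕ; suc; _≤_; _<_)
open import Data.Fin using (Fin; inject₁; fromℕ) renaming (suc to fsuc; zero to fzero)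
open import Data.Product using (Σ; _×_; ∃-syntax)
open import Data.Sum using (_⊎_)
open import Relation.Nullary using (¬_; Dec)
open import Relation.Binary.PropositionalEquality using (_≡_)
open import Function.Definitions using (Injective)

-- A finite digraph: vertex set Fin n, decidable arc relation, no loops.
-- (Multiple arcs in the same direction are irrelevant for a relation.)
record Digraph : Set₁ where
  field
    n     : ℕ
    Arc   : Fin n → Fin n → Set
    arc?  : (u v : Fin n) → Dec (Arc u v)
    loopless : (v : Fin n) → ¬ Arc v v

open Digraph public

Vertex : Digraph → Set
Vertex D = Fin (n D)

record IsPath (D : Digraph) (ℓ : ℕ) (p : Fin (suc ℓ) → Vertex D) : Set where
  field
    distinct : Injective _≡_ _≡_ p
    arcs     : (i : Fin ℓ) → Arc D (p (inject₁ i)) (p (fsuc i))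

PathOfLength : (D : Digraph) → Vertex D → Vertex D → ℕ → Set
PathOfLength D u v ℓ =
  Σ (Fin (suc ℓ) → Vertex D) λ p → IsPath D ℓ p × (p fzero ≡ u) × (p (fromℕ ℓ) ≡ v)

DistLe : (D : Digraph) → Vertex D → Vertex D → ℕ → Set
DistLe D u v m = ∃[ ℓ ] (ℓ ≤ m × PathOfLength D u v ℓ)

KQuasiTransitive : ℕ → Digraph → Set
KQuasiTransitive k D =
  (p : Fin (suc k) → Vertex D) → IsPath D k p →
  Arc D (p fzero) (p (fromℕ k)) ⊎ Arc D (p (fromℕ k)) (p fzero)

IsShortestPath : (D : Digraph) (ℓ : ℕ) → (Fin (suc ℓ) → Vertex D) → Set
IsShortestPath D ℓ p =
  IsPath D ℓ p × ((m : ℕ) → m < ℓ → ¬ PathOfLength D (p fzero) (p (fromℕ ℓ)) m)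

-- Write v = u_{k+2} and c = k - 1.  Any k-path from v to a vertex x with d(u₀,x) ≤ k
-- yields v → x: the reverse arc would give d(u₀,v) ≤ k + 1.  Applying k-quasi-transitivity
-- to the subpaths u₀…u_k and u₂…u_{k+2} gives u_k → u₀ and v → u₂.  For a path
-- q₀ = u₀, …, q_ℓ we then get v → q_ℓ in two ways:
--   wrapping, if ℓ ≤ k - 2 and v → u_{ℓ+2}: use v, u_{ℓ+2}, …, u_k, q₀, …, q_ℓ;
--   shortcut, if ℓ = c + s and v → q_s:     use v, q_s, …, q_ℓ;
-- these are paths because d(u₀,q_j) ≤ j < d(u₀,u_i) for j < i.  From v → u₂ we get
-- v → u₀, then v → u_{k-1}, which wraps down by twos to v → u₁ since k - 1 is odd;
-- then v → u_k, and wrapping down from u_{k-1} and u_k reaches every u_a.  Finally a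
-- path from u₀ of length ℓ ≤ k - 2 wraps, one of length k - 1 is a shortcut with s = 0,
-- and one of length k is a shortcut with s = 1, using v → q₁ from the previous cases.
module Submission where

open import Defs
open import Data.Nat using (ℕ; suc; _≤_; _+_)
open import Data.Nat.Divisibility using (_∣_)
open import Data.Fin using (Fin; fromℕ) renaming (zero to fzero)

open import Data.Nat using (zero; _<_; _∸_; _*_; z≤n; s≤s)
open import Data.Nat.Properties
open import Data.Nat.DivMod using (_mod_; m%n<n; m<n⇒m%n≡m)
open import Data.Nat.Divisibility using (divides)
open import Data.Fin using (toℕ; fromℕ<)
open import Data.Fin.Properties
  using (toℕ-injective; toℕ-fromℕ; toℕ-fromℕ<; toℕ-inject₁; toℕ≤pred[n]; toℕ<n; any?)
  renaming (_≟_ to _≟ᶠ_)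
open import Data.Product using (_×_; _,_; proj₁; proj₂; ∃-syntax)
open import Data.Sum using (_⊎_; inj₁; inj₂; [_,_])
open import Data.Empty using (⊥-elim)
open import Relation.Nullary using (¬_; yes; no)
open import Relation.Binary.PropositionalEquality
  using (_≡_; _≢_; refl; sym; trans; cong; subst; subst₂)

index : (ℓ : ℕ) → ℕ → Fin (suc ℓ)
index ℓ i = i mod suc ℓ

toℕ-index : ∀ {ℓ i} → i ≤ ℓ → toℕ (index ℓ i) ≡ i
toℕ-index {ℓ} {i} i≤ℓ = trans (toℕ-fromℕ< (m%n<n i (suc ℓ))) (m<n⇒m%n≡m (s≤s i≤ℓ))

index-toℕ : ∀ {ℓ i} (x : Fin (suc ℓ)) → toℕ x ≡ i → index ℓ i ≡ x
index-toℕ x refl = toℕ-injective (toℕ-index (toℕ≤pred[n] x))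

module Paths (D : Digraph) where

  record Path (p : ℕ → Vertex D) (ℓ : ℕ) : Set where
    field
      arc       : ∀ {i} → i < ℓ → Arc D (p i) (p (suc i))
      injective : ∀ {i j} → i ≤ ℓ → j ≤ ℓ → p i ≡ p j → i ≡ j

  open Path

  trivial : ∀ z → Path (λ _ → z) 0
  trivial z = record { arc = λ () ; injective = λ { z≤n z≤n _ → refl } }

  take : ∀ {p ℓ j} → Path p ℓ → j ≤ ℓ → Path p j
  take P j≤ℓ = record
    { arc       = λ i<j → arc P (≤-trans i<j j≤ℓ)
    ; injective = λ i≤j i'≤j → injective P (≤-trans i≤j j≤ℓ) (≤-trans i'≤j j≤ℓ)
    }

  shift : ∀ {p ℓ s t} → Path p ℓ → t + s ≤ ℓ → Path (λ i → p (i + s)) t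
  shift {s = s} {t} P t+s≤ℓ = record
    { arc       = λ i<t → arc P (≤-trans (+-monoˡ-≤ s i<t) t+s≤ℓ)
    ; injective = λ {i} {j} i≤t j≤t e → +-cancelʳ-≡ s i j
        (injective P (bound i≤t) (bound j≤t) e)
    }
    where
    bound : ∀ {i} → i ≤ t → i + s ≤ _
    bound i≤t = ≤-trans (+-monoˡ-≤ s i≤t) t+s≤ℓ

  _++⟨_⟩_ : (ℕ → Vertex D) → ℕ → (ℕ → Vertex D) → ℕ → Vertex D
  (p ++⟨ a ⟩ q) i with i ≤? a
  ... | yes _ = p i
  ... | no  _ = q (i ∸ suc a)

  ++-left : ∀ p a q {i} → i ≤ a → (p ++⟨ a ⟩ q) i ≡ p i
  ++-left p a q {i} i≤a with i ≤? a
  ... | yes _  = refl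
  ... | no i≰a = ⊥-elim (i≰a i≤a)

  ++-right : ∀ p a q r → (p ++⟨ a ⟩ q) (suc a + r) ≡ q r
  ++-right p a q r with suc a + r ≤? a
  ... | yes a<a = ⊥-elim (<⇒≱ (m≤m+n (suc a) r) a<a)
  ... | no  _   = cong q (m+n∸m≡n (suc a) r)

  data Side (a : ℕ) : ℕ → Set where
    left  : ∀ {i} → i ≤ a → Side a i
    right : ∀ r → Side a (suc a + r)

  side : ∀ a i → Side a i
  side a i with i ≤? a
  ... | yes i≤a = left i≤a
  ... | no  i≰a = subst (Side a) (m+[n∸m]≡n (≰⇒> i≰a)) (right (i ∸ suc a))

  Avoids : (ℕ → Vertex D) → ℕ → Vertex D → Set
  Avoids p ℓ x = ∀ {i} → i ≤ ℓ → p i ≢ x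

  append : ∀ {p q a b} → Path p a → Arc D (p a) (q 0) → Path q b →
           (∀ {j} → j ≤ b → Avoids p a (q j)) → Path (p ++⟨ a ⟩ q) (suc a + b)
  append {p} {q} {a} {b} P bridge Q disjoint = record { arc = arc′ ; injective = injective′ }
    where
    pq = p ++⟨ a ⟩ q

    pq-left : ∀ {i} → i ≤ a → pq i ≡ p i
    pq-left = ++-left p a q

    pq-right : ∀ r → pq (suc a + r) ≡ q r
    pq-right = ++-right p a q

    right≤ : ∀ {r} → suc a + r ≤ suc a + b → r ≤ b
    right≤ = +-cancelˡ-≤ (suc a) _ _

    arc′ : ∀ {i} → i < suc a + b → Arc D (pq i) (pq (suc i))
    arc′ {i} i< with side a i
    ... | right r = subst₂ (Arc D) (sym (pq-right r))
                      (trans (sym (pq-right (suc r))) (cong pq (+-suc (suc a) r)))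
                      (arc Q (+-cancelˡ-< (suc a) r b i<))
    ... | left i≤a with m≤n⇒m<n∨m≡n i≤a
    ...   | inj₁ i<a  = subst₂ (Arc D) (sym (pq-left i≤a)) (sym (pq-left i<a)) (arc P i<a)
    ...   | inj₂ refl = subst₂ (Arc D) (sym (pq-left i≤a))
                          (trans (sym (pq-right 0)) (cong pq (+-identityʳ (suc a)))) bridge

    injective′ : ∀ {i j} → i ≤ suc a + b → j ≤ suc a + b → pq i ≡ pq j → i ≡ j
    injective′ {i} {j} i≤ j≤ e with side a i | side a j
    ... | left i≤a | left j≤a = injective P i≤a j≤a
                                  (trans (sym (pq-left i≤a)) (trans e (pq-left j≤a)))
    ... | left i≤a | right r  = ⊥-elim (disjoint (right≤ j≤) i≤a
                                  (trans (sym (pq-left i≤a)) (trans e (pq-right r))))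
    ... | right r  | left j≤a = ⊥-elim (disjoint (right≤ i≤) j≤a
                                  (trans (sym (pq-left j≤a)) (trans (sym e) (pq-right r))))
    ... | right r  | right r′ = cong (suc a +_) (injective Q (right≤ i≤) (right≤ j≤)
                                  (trans (sym (pq-right r)) (trans e (pq-right r′))))

  ++-avoids : ∀ {p q a b x} → Avoids p a x → Avoids q b x → Avoids (p ++⟨ a ⟩ q) (suc a + b) x
  ++-avoids {p} {q} {a} p∌x q∌x {i} i≤ with side a i
  ... | left i≤a = λ e → p∌x i≤a (trans (sym (++-left p a q i≤a)) e)
  ... | right r  = λ e → q∌x (+-cancelˡ-≤ (suc a) _ _ i≤) (trans (sym (++-right p a q r)) e)

  Reach : Vertex D → Vertex D → ℕ → Set
  Reach x y n = ∃[ ℓ ] ℓ ≤ n × ∃[ p ] Path p ℓ × p 0 ≡ x × p ℓ ≡ y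

  Reach-weaken : ∀ {x y n n′} → n ≤ n′ → Reach x y n → Reach x y n′
  Reach-weaken n≤n′ (ℓ , ℓ≤n , rest) = ℓ , ≤-trans ℓ≤n n≤n′ , rest

  reach : ∀ {p ℓ x j} → Path p ℓ → p 0 ≡ x → j ≤ ℓ → Reach x (p j) j
  reach P p₀ j≤ℓ = _ , ≤-refl , _ , take P j≤ℓ , p₀ , refl

  -- If z already lies on the path, cut the path there instead of appending z.
  Reach-snoc : ∀ {x y z n} → Reach x y n → Arc D y z → Reach x z (suc n)
  Reach-snoc {z = z} {n} (ℓ , ℓ≤n , p , P , p₀ , pℓ) y→z
    with any? (λ (t : Fin (suc ℓ)) → p (toℕ t) ≟ᶠ z)
  ... | yes (t , pt≡z) =
    toℕ t , ≤-trans (toℕ≤pred[n] t) (m≤n⇒m≤1+n ℓ≤n) , p , take P (toℕ≤pred[n] t) , p₀ , pt≡z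
  ... | no z∉p =
    suc ℓ + 0 , subst (_≤ suc n) (sym (+-identityʳ (suc ℓ))) (s≤s ℓ≤n) , _
    , append P (subst (λ y → Arc D y z) (sym pℓ) y→z) (trivial z) (λ _ → avoid)
    , trans (++-left p ℓ (λ _ → z) z≤n) p₀ , ++-right p ℓ (λ _ → z) 0
    where
    avoid : Avoids p ℓ z
    avoid {i} i≤ℓ pi≡z = z∉p (index ℓ i , subst (λ i → p i ≡ z) (sym (toℕ-index i≤ℓ)) pi≡z)

  Reach-along : ∀ {p L x i n} t → Path p L → t + i ≤ L → Reach x (p i) n →
                Reach x (p (t + i)) (t + n)
  Reach-along zero    P _   r = r
  Reach-along (suc t) P t+i<L r = Reach-snoc (Reach-along t P (<⇒≤ t+i<L) r) (Path.arc P t+i<L)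

  toIsPath : ∀ {p ℓ} → Path p ℓ → IsPath D ℓ (λ x → p (toℕ x))
  toIsPath {p} P = record
    { distinct = λ {x} {y} e → toℕ-injective (injective P (toℕ≤pred[n] x) (toℕ≤pred[n] y) e)
    ; arcs     = λ i → subst (λ j → Arc D (p j) (p (suc (toℕ i)))) (sym (toℕ-inject₁ i))
                           (arc P (toℕ<n i))
    }

  fromIsPath : ∀ {ℓ p} → IsPath D ℓ p → Path (λ i → p (index ℓ i)) ℓ
  fromIsPath {ℓ} {p} P = record
    { arc       = λ i<ℓ → subst₂ (Arc D)
                    (cong p (sym (index-toℕ _ (trans (toℕ-inject₁ _) (toℕ-fromℕ< i<ℓ)))))
                    (cong p (sym (index-toℕ _ (cong suc (toℕ-fromℕ< i<ℓ)))))
                    (IsPath.arcs P (fromℕ< i<ℓ))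
    ; injective = λ i≤ℓ j≤ℓ e → trans (sym (toℕ-index i≤ℓ))
                    (trans (cong toℕ (IsPath.distinct P e)) (toℕ-index j≤ℓ))
    }

  toPathOfLength : ∀ {p ℓ} → Path p ℓ → PathOfLength D (p 0) (p ℓ) ℓ
  toPathOfLength {p} {ℓ} P = _ , toIsPath P , refl , cong p (toℕ-fromℕ ℓ)

  fromDistLe : ∀ {x y n} → DistLe D x y n → Reach x y n
  fromDistLe (ℓ , ℓ≤n , p , P , p₀ , pℓ) =
    ℓ , ℓ≤n , _ , fromIsPath P , trans (cong p (index-toℕ fzero refl)) p₀
    , trans (cong p (index-toℕ (fromℕ ℓ) (toℕ-fromℕ ℓ))) pℓ

  quasiTransitive : ∀ {k p} → KQuasiTransitive k D → Path p k →
                    Arc D (p 0) (p k) ⊎ Arc D (p k) (p 0)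
  quasiTransitive {k} {p} kq P =
    subst (λ j → Arc D (p 0) (p j) ⊎ Arc D (p j) (p 0)) (toℕ-fromℕ k) (kq _ (toIsPath P))

module _ {ℓ} {P : ℕ → Set ℓ} where

  StepsDownByTwo : ℕ → Set ℓ
  StepsDownByTwo t = ∀ {a} → 2 + a ≤ t → P (2 + a) → P a

  down-by-twos : ∀ {t} → StepsDownByTwo t → ∀ n {a} → n * 2 + a ≤ t → P (n * 2 + a) → P a
  down-by-twos down zero    _ Pa = Pa
  down-by-twos down (suc n) h Pa = down-by-twos down n (≤-trans (m≤n+m _ 2) h) (down h Pa)

  down-from-top : ∀ {c} → StepsDownByTwo (suc c) → P c → P (suc c) → ∀ {a} → a ≤ suc c → P a
  down-from-top {c} down Pc Psc {a} a≤ with m≤n⇒m<n∨m≡n a≤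
  ... | inj₂ refl = Psc
  ... | inj₁ a<   = proj₁ (pairs (c ∸ a) (m∸n+n≡m (≤-pred a<)))
    where
    pairs : ∀ d {a} → d + a ≡ c → P a × P (suc a)
    pairs zero    refl = Pc , Psc
    pairs (suc d) {a} e with pairs d {suc a} (trans (+-suc d a) e)
    ... | Psa , Pssa = down (s≤s (subst (suc a ≤_) e (s≤s (m≤n+m a d)))) Pssa , Psa

module EvenCase (m : ℕ) (D : Digraph) (kq : KQuasiTransitive (suc m * 2) D)
                (u : Fin (suc (suc m * 2 + 2)) → Vertex D)
                (sp : IsShortestPath D (suc m * 2 + 2) u) where
  open Paths D

  c k : ℕ
  c = suc (m * 2)
  k = suc c

  U : ℕ → Vertex D
  U i = u (index (k + 2) i)

  U-path : Path U (k + 2)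
  U-path = fromIsPath (proj₁ sp)

  u₀ v : Vertex D
  u₀ = U 0
  v  = U (k + 2)

  k≤k+2 : k ≤ k + 2
  k≤k+2 = m≤m+n k 2

  U-start : u₀ ≡ u fzero
  U-start = cong u (index-toℕ fzero refl)

  U-end : v ≡ u (fromℕ (k + 2))
  U-end = cong u (index-toℕ (fromℕ (k + 2)) (toℕ-fromℕ (k + 2)))

  shortest : ∀ {n} → n < k + 2 → ¬ Reach u₀ v n
  shortest n< (ℓ , ℓ≤n , p , P , p₀ , pℓ) = proj₂ sp ℓ (≤-<-trans ℓ≤n n<)
    (subst₂ (λ x y → PathOfLength D x y ℓ) (trans p₀ U-start) (trans pℓ U-end) (toPathOfLength P))

  2≤k : 2 ≤ k
  2≤k = s≤s (s≤s z≤n)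

  k<k+2 : k < k + 2
  k<k+2 = ≤-trans (n≤1+n (suc k)) (≤-reflexive (+-comm 2 k))

  U-far : ∀ {i n} → i ≤ k + 2 → n < i → ¬ Reach u₀ (U i) n
  U-far {i} {n} i≤ n<i r =
    shortest (subst (t + n <_) t+i≡ (+-monoʳ-< t n<i))
      (subst (λ j → Reach u₀ (U j) (t + n)) t+i≡ (Reach-along t U-path (≤-reflexive t+i≡) r))
    where
    t = k + 2 ∸ i
    t+i≡ : t + i ≡ k + 2
    t+i≡ = m∸n+n≡m i≤

  off-U : ∀ {q ℓ i j} → Path q ℓ → q 0 ≡ u₀ → j ≤ ℓ → j < i → i ≤ k + 2 → q j ≢ U i
  off-U Q q₀ j≤ℓ j<i i≤ qj≡Ui = U-far i≤ j<i (subst (λ y → Reach u₀ y _) qj≡Ui (reach Q q₀ j≤ℓ))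

  path-avoids-v : ∀ {q ℓ} → Path q ℓ → q 0 ≡ u₀ → ℓ ≤ k → Avoids q ℓ v
  path-avoids-v Q q₀ ℓ≤k j≤ℓ = off-U Q q₀ j≤ℓ (≤-<-trans j≤ℓ (≤-<-trans ℓ≤k k<k+2)) ≤-refl

  reach-end : ∀ {q ℓ} → Path q ℓ → q 0 ≡ u₀ → ℓ ≤ k → Reach u₀ (q ℓ) k
  reach-end Q q₀ ℓ≤k = Reach-weaken ℓ≤k (reach Q q₀ ≤-refl)

  arc-from-v : ∀ {w x} → Path w c → Arc D v (w 0) → Avoids w c v → w c ≡ x → Reach u₀ x k →
               Arc D v x
  arc-from-v {w} W v→w₀ W∌v wc≡x r =
    [ subst₂ (Arc D) h₀≡v hk≡x
    , (λ x→v → ⊥-elim (shortest (≤-reflexive (+-comm 2 k))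
                          (Reach-snoc r (subst₂ (Arc D) hk≡x h₀≡v x→v))))
    ] (quasiTransitive kq (append (trivial v) v→w₀ W (λ j≤c _ e → W∌v j≤c (sym e))))
    where
    h₀≡v = ++-left (λ _ → v) 0 w z≤n
    hk≡x = trans (++-right (λ _ → v) 0 w c) wc≡x

  arc-Uk-u₀ : Arc D (U k) u₀
  arc-Uk-u₀ with quasiTransitive kq (take U-path k≤k+2)
  ... | inj₁ u₀→Uk = ⊥-elim (U-far k≤k+2 2≤k (Reach-snoc (reach U-path refl z≤n) u₀→Uk))
  ... | inj₂ Uk→u₀ = Uk→u₀

  arc-v-U₂ : Arc D v (U 2)
  arc-v-U₂ with quasiTransitive kq (shift {s = 2} {t = k} U-path ≤-refl)
  ... | inj₁ U₂→v = ⊥-elim (shortest (+-monoˡ-≤ 2 2≤k)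
                      (Reach-snoc (reach U-path refl (≤-trans 2≤k k≤k+2)) U₂→v))
  ... | inj₂ v→U₂ = v→U₂

  arc-wrap : ∀ {q ℓ} → Path q ℓ → q 0 ≡ u₀ → 2 + ℓ ≤ k → Arc D v (U (2 + ℓ)) → Arc D v (q ℓ)
  arc-wrap {q} {ℓ} Q q₀ 2+ℓ≤k v→U =
    arc-from-v (subst (Path W) len (append seg-path bridge Q q∌seg)) v→U
      (subst (λ n → Avoids W n v) len (++-avoids seg∌v (path-avoids-v Q q₀ ℓ≤k)))
      (trans (cong W (sym len)) (++-right seg j q ℓ)) (reach-end Q q₀ ℓ≤k)
    where
    j = k ∸ (2 + ℓ)
    j+2+ℓ≡k : j + (2 + ℓ) ≡ k
    j+2+ℓ≡k = m∸n+n≡m 2+ℓ≤k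
    ℓ≤k : ℓ ≤ k
    ℓ≤k = ≤-trans (m≤n+m ℓ 2) 2+ℓ≤k
    seg : ℕ → Vertex D
    seg i = U (i + (2 + ℓ))
    W = seg ++⟨ j ⟩ q
    len : suc j + ℓ ≡ c
    len = suc-injective (trans (sym (trans (+-suc j (suc ℓ)) (cong suc (+-suc j ℓ)))) j+2+ℓ≡k)
    seg≤ : ∀ {i} → i ≤ j → i + (2 + ℓ) ≤ k
    seg≤ {i} i≤j = subst (i + (2 + ℓ) ≤_) j+2+ℓ≡k (+-monoˡ-≤ (2 + ℓ) i≤j)
    seg-path : Path seg j
    seg-path = shift U-path (≤-trans (seg≤ ≤-refl) k≤k+2)
    bridge : Arc D (seg j) (q 0)
    bridge = subst₂ (Arc D) (cong U (sym j+2+ℓ≡k)) (sym q₀) arc-Uk-u₀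
    seg∌v : Avoids seg j v
    seg∌v i≤j e = <⇒≢ (≤-<-trans (seg≤ i≤j) k<k+2)
      (Path.injective U-path (≤-trans (seg≤ i≤j) k≤k+2) ≤-refl e)
    q∌seg : ∀ {j′} → j′ ≤ ℓ → Avoids seg j (q j′)
    q∌seg j′≤ℓ {i} i≤j e = off-U Q q₀ j′≤ℓ (≤-trans (s≤s j′≤ℓ) (≤-trans (m≤n+m _ 1) (m≤n+m _ i)))
      (≤-trans (seg≤ i≤j) k≤k+2) (sym e)

  arc-shortcut : ∀ {q ℓ} s → Path q ℓ → q 0 ≡ u₀ → c + s ≡ ℓ → ℓ ≤ k → Arc D v (q s) →
                 Arc D v (q ℓ)
  arc-shortcut {q} s Q q₀ c+s≡ℓ ℓ≤k v→qs =
    arc-from-v (shift Q (≤-reflexive c+s≡ℓ)) v→qs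
      (λ j≤c → path-avoids-v Q q₀ ℓ≤k (≤-trans (+-monoˡ-≤ s j≤c) (≤-reflexive c+s≡ℓ)))
      (cong q c+s≡ℓ) (reach-end Q q₀ ℓ≤k)

  arc-v-u₀ : Arc D v u₀
  arc-v-u₀ = arc-wrap (trivial u₀) refl 2≤k arc-v-U₂

  arc-down : ∀ {a} → 2 + a ≤ k → Arc D v (U (2 + a)) → Arc D v (U a)
  arc-down {a} 2+a≤k = arc-wrap (take U-path (≤-trans (m≤n+m a 2) (≤-trans 2+a≤k k≤k+2))) refl 2+a≤k

  arc-v-Uc : Arc D v (U c)
  arc-v-Uc = arc-shortcut 0 (take U-path (≤-trans (n≤1+n c) k≤k+2)) refl (+-identityʳ c) (n≤1+n c)
               arc-v-u₀

  -- c = 2m + 1 is odd: this is where the parity of k enters.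
  arc-v-U₁ : Arc D v (U 1)
  arc-v-U₁ = down-by-twos {P = λ a → Arc D v (U a)} arc-down m
    (≤-trans (≤-reflexive (+-comm (m * 2) 1)) (n≤1+n c))
    (subst (λ i → Arc D v (U i)) (+-comm 1 (m * 2)) arc-v-Uc)

  arc-v-Uk : Arc D v (U k)
  arc-v-Uk = arc-shortcut 1 (take U-path k≤k+2) refl (+-comm c 1) ≤-refl arc-v-U₁

  arc-v-U : ∀ {a} → a ≤ k → Arc D v (U a)
  arc-v-U = down-from-top {P = λ a → Arc D v (U a)} arc-down arc-v-Uc arc-v-Uk

  arc-v-path-end< : ∀ {q ℓ} → Path q ℓ → q 0 ≡ u₀ → ℓ < k → Arc D v (q ℓ)
  arc-v-path-end< Q q₀ (s≤s ℓ≤c) with m≤n⇒m<n∨m≡n ℓ≤c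
  ... | inj₁ ℓ<c  = arc-wrap Q q₀ (s≤s ℓ<c) (arc-v-U (s≤s ℓ<c))
  ... | inj₂ refl =
    arc-shortcut 0 Q q₀ (+-identityʳ c) (n≤1+n c) (subst (Arc D v) (sym q₀) arc-v-u₀)

  arc-v-path-end : ∀ {q ℓ} → Path q ℓ → q 0 ≡ u₀ → ℓ ≤ k → Arc D v (q ℓ)
  arc-v-path-end Q q₀ ℓ≤k with m≤n⇒m<n∨m≡n ℓ≤k
  ... | inj₁ ℓ<k  = arc-v-path-end< Q q₀ ℓ<k
  ... | inj₂ refl =
    arc-shortcut 1 Q q₀ (+-comm c 1) ≤-refl (arc-v-path-end< (take Q (s≤s z≤n)) q₀ 2≤k)

  theorem : ∀ w → DistLe D (u fzero) w k → Arc D (u (fromℕ (k + 2))) w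
  theorem w r with subst (λ x → Reach x w k) (sym U-start) (fromDistLe r)
  ... | ℓ , ℓ≤k , q , Q , q₀ , qℓ = subst₂ (Arc D) U-end qℓ (arc-v-path-end Q q₀ ℓ≤k)

mainTheorem19 : (k : ℕ) → 2 ≤ k → 2 ∣ k → (D : Digraph) → KQuasiTransitive k D →
    (u : Fin (suc (k + 2)) → Vertex D) → IsShortestPath D (k + 2) u →
    (w : Vertex D) → DistLe D (u fzero) w k → Arc D (u (fromℕ (k + 2))) w
mainTheorem19 _ ()  (divides zero    refl)
mainTheorem19 _ _   (divides (suc m) refl) = EvenCase.theorem m
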